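{- Let $s\ge 2$ and $n_1,\ldots,n_s\ge 1$ be integers, $n=n_1+\cdots+n_s$, and let $K_{n_1,\ldots,n_s}$ be the complete $s$-partite graph with partition sets $X_1,\ldots,X_s$, $|X_i|=n_i$. Let $F$ be a spanning forest of $K_{n_1,\ldots,n_s}$ with components $T_1,\ldots,T_c$, and put $n_{ip}=|X_i\cap V(T_p)|$, $m_p=|V(T_p)|$, $\alpha_p=nm_p-\sum_{i=1}^s n_in_{ip}$. Let $Z(0)$ be the $s\times s$ matrix with $(i,j)$ entry $\delta_{ij}-\sum_{p=1}^c\frac{n_{jp}(m_p-n_{ip})}{\alpha_p}$, let $\mathbf{b}=(n_1,\ldots,n_s)^{\top}$ and let $\mathbf{e}$ be the all-ones vector in $\mathbb{R}^s$. Then there is a constant $\gamma$ such that $\operatorname{adj}Z(0)=\gamma(n\mathbf{e}-\mathbf{b})\mathbf{b}^{\top}$. Moreover, for any $i,j\in\{1,\ldots,s\}$, $$\gamma=\frac{C_{ij}}{n_i(n-n_j)},$$ where $C_{ij}$ is the cofactor of $Z(0)$ corresponding to the $(i,j)$ entry.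
   Context: $\delta_{ij}$ is the Kronecker delta. $\operatorname{adj}M$ is the adjugate of $M$ (its $(i,j)$ entry is the cofactor of $M$ at position $(j,i)$); the cofactor $C_{ij}$ is $(-1)^{i+j}$ times the determinant of the matrix obtained by deleting row $i$ and column $j$. -}

module Defs where

open import Data.Nat as ℕ using (ℕ; zero; suc)
open import Data.Integer using (+_)
open import Data.Rational as ℚ using (ℚ; 0ℚ; 1ℚ; _+_; _*_; _-_; -_; _÷_)
open import Data.Fin as Fin using (Fin; zero; suc; punchIn; inject₁; fromℕ; toℕ)
open import Data.Vec using (Vec; lookup)
open import Data.Bool using (Bool; if_then_else_)
open import Data.Product using (Σ; ∃; _×_; _,_; proj₁)
open import Relation.Binary.PropositionalEquality using (_≡_; _≢_)
open import Relation.Nullary using (¬_; does; yes; no)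
open import Relation.Binary.Construct.Closure.ReflexiveTransitive using (Star)

sumℕ : ∀ {k} → (Fin k → ℕ) → ℕ
sumℕ {zero}  f = 0
sumℕ {suc k} f = f zero ℕ.+ sumℕ (λ i → f (suc i))

sumℚ : ∀ {k} → (Fin k → ℚ) → ℚ
sumℚ {zero}  f = 0ℚ
sumℚ {suc k} f = f zero + sumℚ (λ i → f (suc i))

count : ∀ {k} → (Fin k → Bool) → ℕ
count f = sumℕ (λ i → if f i then 1 else 0)

ℕ→ℚ : ℕ → ℚ
ℕ→ℚ k = + k ℚ./ 1

-- total division; only ever applied to nonzero denominators in the statement
infixl 7 _/ℚ_
_/ℚ_ : ℚ → ℚ → ℚ
p /ℚ q with q ℚ.≟ 0ℚ
... | yes _ = 0ℚ
... | no q≢0 = _÷_ p q {{ℚ.≢-nonZero q≢0}}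

δ : ∀ {k} → Fin k → Fin k → ℚ
δ i j = if does (i Fin.≟ j) then 1ℚ else 0ℚ

Matrix : ℕ → Set
Matrix k = Fin k → Fin k → ℚ

sign : ℕ → ℚ
sign zero = 1ℚ
sign (suc zero) = - 1ℚ
sign (suc (suc k)) = sign k

det : ∀ {k} → Matrix k → ℚ
det {zero}  A = 1ℚ
det {suc k} A = sumℚ (λ j → sign (toℕ j) * A zero j * det (λ a b → A (suc a) (punchIn j b)))

cofactor : ∀ {k} → Matrix k → Fin k → Fin k → ℚ
cofactor {suc k} A i j = sign (toℕ i ℕ.+ toℕ j) * det (λ a b → A (punchIn i a) (punchIn j b))

adjugate : ∀ {k} → Matrix k → Matrix k
adjugate A i j = cofactor A j i

-- Complete multipartite graph K_{n_1,...,n_s}: vertex (i , a) lies in X_i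

Vertex : ∀ {s} → (Fin s → ℕ) → Set
Vertex {s} ns = Σ (Fin s) (λ i → Fin (ns i))

-- a cycle: k ≥ 3 distinct vertices w_0,...,w_{k-1}, w_j ~ w_{j+1}, w_{k-1} ~ w_0
HasCycle : {V : Set} → (V → V → Set) → Set
HasCycle {V} E = Σ ℕ λ k → Σ (Vec V (3 ℕ.+ k)) λ w →
    (∀ a b → lookup w a ≡ lookup w b → a ≡ b)
  × (∀ (j : Fin (2 ℕ.+ k)) → E (lookup w (inject₁ j)) (lookup w (suc j)))
  × E (lookup w (fromℕ (2 ℕ.+ k))) (lookup w zero)

-- F is a spanning forest of K_{n_1,...,n_s}: a simple graph on all vertices
-- whose edges are edges of K (join different parts), with no cycle
IsSpanningForest : ∀ {s} (ns : Fin s → ℕ) → (Vertex ns → Vertex ns → Set) → Set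
IsSpanningForest ns F =
    (∀ u v → F u v → F v u)
  × (∀ u v → F u v → proj₁ u ≢ proj₁ v)
  × ¬ HasCycle F

-- comp : V → Fin c enumerates the components T_1..T_c of F (T_p = comp⁻¹ p)
AreComponents : {V : Set} (F : V → V → Set) (c : ℕ) → (V → Fin c) → Set
AreComponents {V} F c comp =
    (∀ u v → comp u ≡ comp v → Star F u v)
  × (∀ u v → Star F u v → comp u ≡ comp v)
  × (∀ p → ∃ λ v → comp v ≡ p)

nTot : ∀ {s} → (Fin s → ℕ) → ℕ
nTot ns = sumℕ ns

module _ {s : ℕ} (ns : Fin s → ℕ) {c : ℕ} (comp : Vertex ns → Fin c) where

  nip : Fin s → Fin c → ℕ
  nip i p = count (λ a → does (comp (i , a) Fin.≟ p))

  mp : Fin c → ℕ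
  mp p = sumℕ (λ i → nip i p)

  αp : Fin c → ℚ
  αp p = ℕ→ℚ (nTot ns) * ℕ→ℚ (mp p) - sumℚ (λ i → ℕ→ℚ (ns i) * ℕ→ℚ (nip i p))

  Z0 : Matrix s
  Z0 i j = δ i j - sumℚ (λ p → (ℕ→ℚ (nip j p) * (ℕ→ℚ (mp p) - ℕ→ℚ (nip i p))) /ℚ αp p)

-- Z(0) has the right null vector w = n𝐞 − 𝐛 and the left null vector 𝐛: summing the
-- entries of Z(0) against them reduces to α_p = Σ_j n_jp (n − n_j) = Σ_i n_i (m_p − n_ip),
-- which also shows α_p > 0.  For any square matrix A with A w = 0 and 𝐛ᵀ A = 0, the
-- submatrices obtained by deleting rows i and i+1 differ in a single row; putting the
-- vanishing combination 𝐛ᵀ A there and using multilinearity and alternation of det gives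
-- b_{i+1} C_ij = b_i C_{i+1,j}, and dually w_{j+1} C_ij = w_j C_{i,j+1}.  With all b_i and
-- w_j nonzero these chain to C_ij = γ b_i w_j, i.e. adj A = γ w 𝐛ᵀ.

module Submission where

open import Defs
open import Data.Nat as ℕ using (ℕ; zero; suc; _≤_; s≤s; z≤n)
import Data.Nat.Properties as ℕ
open import Data.Nat.Tactic.RingSolver using (solve-∀)
import Data.Integer as ℤ
import Data.Integer.Properties as ℤ
open import Data.Rational as ℚ using (ℚ; 0ℚ; 1ℚ; ½; _+_; _*_; _-_; -_; toℚᵘ)
open import Data.Rational.Properties
import Data.Rational.Unnormalised as ℚᵘ
import Data.Rational.Unnormalised.Properties as ℚᵘ
open import Data.Fin as Fin using (Fin; zero; suc; punchIn; punchOut; inject₁; toℕ)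
import Data.Fin.Properties as Fin
open import Data.Fin.Induction using (<-weakInduction)
open import Data.Vec.Functional using (updateAt)
open import Data.Vec.Functional.Properties
  using (updateAt-updates; updateAt-minimal; updateAt-id-local; map-updateAt-local)
open import Data.Bool using (if_then_else_)
open import Data.Bool.Properties using (if-float)
open import Data.Product using (∃; _×_; _,_; proj₁; proj₂)
open import Function using (_∘_; const)
open import Relation.Binary.PropositionalEquality
open import Relation.Nullary using (does; yes; no; contradiction)
open import Relation.Nullary.Decidable using (dec-true; dec-false)
open import Algebra.Properties.Ring +-*-ring using (x[y-z]≈xy-xz; [y-z]x≈yx-zx)

open import Data.Rational.Solver using (module +-*-Solver)
open +-*-Solver
open ≡-Reasoning

*-leftComm : ∀ a b c → a * (b * c) ≡ b * (a * c)
*-leftComm = solve 3 (λ a b c → a :* (b :* c) := b :* (a :* c)) refl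

*-cancelˡ-≢0 : ∀ {p q r} → p ≢ 0ℚ → p * q ≡ p * r → q ≡ r
*-cancelˡ-≢0 {p} {q} {r} p≢0 pq≡pr = begin
  q                 ≡⟨ reassoc q ⟩
  (1/p * p) * q     ≡⟨ *-assoc 1/p p q ⟩
  1/p * (p * q)     ≡⟨ cong (1/p *_) pq≡pr ⟩
  1/p * (p * r)     ≡⟨ *-assoc 1/p p r ⟨
  (1/p * p) * r     ≡⟨ reassoc r ⟨
  r                 ∎
  where
  instance
    p-nonZero : ℚ.NonZero p
    p-nonZero = ℚ.≢-nonZero p≢0
  1/p : ℚ
  1/p = ℚ.1/ p
  reassoc : ∀ x → x ≡ (1/p * p) * x
  reassoc x = trans (sym (*-identityˡ x)) (cong (_* x) (sym (*-inverseˡ p)))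

*-≢0 : ∀ {p q} → p ≢ 0ℚ → q ≢ 0ℚ → p * q ≢ 0ℚ
*-≢0 {p} {q} p≢0 q≢0 pq≡0 = q≢0 (*-cancelˡ-≢0 p≢0 (trans pq≡0 (sym (*-zeroʳ p))))

*-/ℚ-cancel : ∀ p {q} → q ≢ 0ℚ → (p * q) /ℚ q ≡ p
*-/ℚ-cancel p {q} q≢0 with q ℚ.≟ 0ℚ
... | yes q≡0 = contradiction q≡0 q≢0
... | no  _   = begin
  (p * q) * ℚ.1/ q  ≡⟨ *-assoc p q _ ⟩
  p * (q * ℚ.1/ q)  ≡⟨ cong (p *_) (*-inverseʳ q) ⟩
  p * 1ℚ            ≡⟨ *-identityʳ p ⟩
  p                 ∎
  where
  instance
    q-nonZero : ℚ.NonZero q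
    q-nonZero = ℚ.≢-nonZero q≢0

/ℚ≡*1/ : ∀ p {q} (q≢0 : q ≢ 0ℚ) → p /ℚ q ≡ p * (ℚ.1/ q) {{ℚ.≢-nonZero q≢0}}
/ℚ≡*1/ p {q} q≢0 with q ℚ.≟ 0ℚ
... | yes q≡0 = contradiction q≡0 q≢0
... | no  _   = refl

toℚᵘ-ℕ→ℚ : ∀ k → toℚᵘ (ℕ→ℚ k) ℚᵘ.≃ ℚᵘ.mkℚᵘ (ℤ.+ k) 0
toℚᵘ-ℕ→ℚ k = toℚᵘ-fromℚᵘ (ℚᵘ.mkℚᵘ (ℤ.+ k) 0)

ℕ→ℚ-+ : ∀ a b → ℕ→ℚ (a ℕ.+ b) ≡ ℕ→ℚ a + ℕ→ℚ b
ℕ→ℚ-+ a b = toℚᵘ-injective (ℚᵘ.≃-trans (toℚᵘ-ℕ→ℚ (a ℕ.+ b))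
  (ℚᵘ.≃-trans (ℚᵘ.*≡* (trans (ℤ.*-identityʳ _) (sym (trans (ℤ.*-identityʳ _)
    (trans (cong₂ ℤ._+_ (ℤ.*-identityʳ (ℤ.+ a)) (ℤ.*-identityʳ (ℤ.+ b))) (sym (ℤ.pos-+ a b)))))))
  (ℚᵘ.≃-sym (ℚᵘ.≃-trans (toℚᵘ-homo-+ (ℕ→ℚ a) (ℕ→ℚ b)) (ℚᵘ.+-cong (toℚᵘ-ℕ→ℚ a) (toℚᵘ-ℕ→ℚ b))))))

ℕ→ℚ-* : ∀ a b → ℕ→ℚ (a ℕ.* b) ≡ ℕ→ℚ a * ℕ→ℚ b
ℕ→ℚ-* a b = toℚᵘ-injective (ℚᵘ.≃-trans (toℚᵘ-ℕ→ℚ (a ℕ.* b))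
  (ℚᵘ.≃-trans (ℚᵘ.*≡* (trans (ℤ.*-identityʳ _) (sym (trans (ℤ.*-identityʳ _) (sym (ℤ.pos-* a b))))))
  (ℚᵘ.≃-sym (ℚᵘ.≃-trans (toℚᵘ-homo-* (ℕ→ℚ a) (ℕ→ℚ b)) (ℚᵘ.*-cong (toℚᵘ-ℕ→ℚ a) (toℚᵘ-ℕ→ℚ b))))))

ℕ→ℚ-≢0 : ∀ {k} → 1 ≤ k → ℕ→ℚ k ≢ 0ℚ
ℕ→ℚ-≢0 {suc k} _ eq with fromℚᵘ-injective {ℚᵘ.mkℚᵘ (ℤ.+ suc k) 0} {ℚᵘ.mkℚᵘ (ℤ.+ 0) 0} eq
... | ℚᵘ.*≡* ()

ℕ→ℚ-sumℕ : ∀ {k} (f : Fin k → ℕ) → ℕ→ℚ (sumℕ f) ≡ sumℚ (ℕ→ℚ ∘ f)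
ℕ→ℚ-sumℕ {zero}  f = refl
ℕ→ℚ-sumℕ {suc k} f = trans (ℕ→ℚ-+ (f zero) _) (cong (ℕ→ℚ (f zero) +_) (ℕ→ℚ-sumℕ (f ∘ suc)))

≤-sumℕ : ∀ {k} (f : Fin k → ℕ) i → f i ≤ sumℕ f
≤-sumℕ f zero    = ℕ.m≤m+n (f zero) _
≤-sumℕ f (suc i) = ℕ.≤-trans (≤-sumℕ (f ∘ suc) i) (ℕ.m≤n+m _ (f zero))

sumℕ-punchIn : ∀ {k} (f : Fin (suc k) → ℕ) i → sumℕ f ≡ f i ℕ.+ sumℕ (f ∘ punchIn i)
sumℕ-punchIn f zero = refl
sumℕ-punchIn {suc k} f (suc i) =
  trans (cong (f zero ℕ.+_) (sumℕ-punchIn (f ∘ suc) i)) (leftComm (f zero) (f (suc i)) _)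
  where
  leftComm : ∀ a b c → a ℕ.+ (b ℕ.+ c) ≡ b ℕ.+ (a ℕ.+ c)
  leftComm = solve-∀

sumℚ-cong : ∀ {k} {f g : Fin k → ℚ} → (∀ i → f i ≡ g i) → sumℚ f ≡ sumℚ g
sumℚ-cong {zero}  f≗g = refl
sumℚ-cong {suc k} f≗g = cong₂ _+_ (f≗g zero) (sumℚ-cong (f≗g ∘ suc))

sumℚ-zero : ∀ {k} {f : Fin k → ℚ} → (∀ i → f i ≡ 0ℚ) → sumℚ f ≡ 0ℚ
sumℚ-zero {zero}  f≗0 = refl
sumℚ-zero {suc k} f≗0 = cong₂ _+_ (f≗0 zero) (sumℚ-zero (f≗0 ∘ suc))

sumℚ-+ : ∀ {k} (f g : Fin k → ℚ) → sumℚ (λ i → f i + g i) ≡ sumℚ f + sumℚ g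
sumℚ-+ {zero}  f g = refl
sumℚ-+ {suc k} f g = trans (cong (f zero + g zero +_) (sumℚ-+ (f ∘ suc) (g ∘ suc)))
  (medial (f zero) (g zero) (sumℚ (f ∘ suc)) (sumℚ (g ∘ suc)))
  where
  medial : ∀ a b c d → (a + b) + (c + d) ≡ (a + c) + (b + d)
  medial = solve 4 (λ a b c d → (a :+ b) :+ (c :+ d) := (a :+ c) :+ (b :+ d)) refl

sumℚ-neg : ∀ {k} (f : Fin k → ℚ) → sumℚ (λ i → - f i) ≡ - sumℚ f
sumℚ-neg {zero}  f = refl
sumℚ-neg {suc k} f = trans (cong (- f zero +_) (sumℚ-neg (f ∘ suc))) (sym (neg-distrib-+ (f zero) _))

sumℚ-- : ∀ {k} (f g : Fin k → ℚ) → sumℚ (λ i → f i - g i) ≡ sumℚ f - sumℚ g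
sumℚ-- f g = trans (sumℚ-+ f (λ i → - g i)) (cong (sumℚ f +_) (sumℚ-neg g))

*-distribˡ-sumℚ : ∀ {k} a (f : Fin k → ℚ) → a * sumℚ f ≡ sumℚ (λ i → a * f i)
*-distribˡ-sumℚ {zero}  a f = *-zeroʳ a
*-distribˡ-sumℚ {suc k} a f = trans (*-distribˡ-+ a (f zero) _) (cong (a * f zero +_) (*-distribˡ-sumℚ a (f ∘ suc)))

sumℚ-comm : ∀ {k l} (f : Fin k → Fin l → ℚ) →
            sumℚ (λ i → sumℚ (f i)) ≡ sumℚ (λ j → sumℚ (λ i → f i j))
sumℚ-comm {zero} {l} f = sym (sumℚ-zero {l} (λ _ → refl))
sumℚ-comm {suc k} f = trans (cong (sumℚ (f zero) +_) (sumℚ-comm (f ∘ suc))) (sym (sumℚ-+ (f zero) _))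

sumℚ-*-sumℚ : ∀ {k l} (g : Fin k → ℚ) (f : Fin k → Fin l → ℚ) →
              sumℚ (λ i → g i * sumℚ (f i)) ≡ sumℚ (λ p → sumℚ (λ i → g i * f i p))
sumℚ-*-sumℚ g f = trans (sumℚ-cong (λ i → *-distribˡ-sumℚ (g i) (f i))) (sumℚ-comm (λ i p → g i * f i p))

sumℚ-single : ∀ {k} (f : Fin k → ℚ) i → (∀ j → j ≢ i → f j ≡ 0ℚ) → sumℚ f ≡ f i
sumℚ-single f zero    f≗0 = trans (cong (f zero +_) (sumℚ-zero (λ j → f≗0 (suc j) λ ()))) (+-identityʳ _)
sumℚ-single f (suc i) f≗0 = trans (cong (_+ sumℚ (f ∘ suc)) (f≗0 zero λ ()))
  (trans (+-identityˡ _) (sumℚ-single (f ∘ suc) i (λ j j≢i → f≗0 (suc j) (j≢i ∘ Fin.suc-injective))))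

sumℚ-pair : ∀ {k} (f : Fin k → ℚ) {i i′} → i ≢ i′ → (∀ j → j ≢ i → j ≢ i′ → f j ≡ 0ℚ) →
            sumℚ f ≡ f i + f i′
sumℚ-pair f {zero}  {zero}   0≢0  f≗0 = contradiction refl 0≢0
sumℚ-pair f {zero}  {suc i′} _    f≗0 =
  cong (f zero +_) (sumℚ-single (f ∘ suc) i′ (λ j j≢i′ → f≗0 (suc j) (λ ()) (j≢i′ ∘ Fin.suc-injective)))
sumℚ-pair f {suc i} {zero}   _    f≗0 = trans (+-comm (f zero) _)
  (cong (_+ f zero) (sumℚ-single (f ∘ suc) i (λ j j≢i → f≗0 (suc j) (j≢i ∘ Fin.suc-injective) (λ ()))))
sumℚ-pair f {suc i} {suc i′} i≢i′ f≗0 = trans (cong (_+ sumℚ (f ∘ suc)) (f≗0 zero (λ ()) (λ ())))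
  (trans (+-identityˡ _) (sumℚ-pair (f ∘ suc) (i≢i′ ∘ cong suc)
    (λ j j≢i j≢i′ → f≗0 (suc j) (j≢i ∘ Fin.suc-injective) (j≢i′ ∘ Fin.suc-injective))))

sumℚ-1 : ∀ k → sumℚ {k} (λ _ → 1ℚ) ≡ ℕ→ℚ k
sumℚ-1 zero    = refl
sumℚ-1 (suc k) = trans (cong (1ℚ +_) (sumℚ-1 k)) (sym (ℕ→ℚ-+ 1 k))

δ-refl : ∀ {k} (i : Fin k) → δ i i ≡ 1ℚ
δ-refl i = cong (if_then 1ℚ else 0ℚ) (dec-true (i Fin.≟ i) refl)

δ-≢ : ∀ {k} {i j : Fin k} → i ≢ j → δ i j ≡ 0ℚ
δ-≢ {i = i} {j} i≢j = cong (if_then 1ℚ else 0ℚ) (dec-false (i Fin.≟ j) i≢j)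

sumℚ-δ-* : ∀ {k} (i : Fin k) (f : Fin k → ℚ) → sumℚ (λ j → δ i j * f j) ≡ f i
sumℚ-δ-* i f = trans (sumℚ-single _ i (λ j j≢i → trans (cong (_* f j) (δ-≢ (j≢i ∘ sym))) (*-zeroˡ (f j))))
  (trans (cong (_* f i) (δ-refl i)) (*-identityˡ (f i)))

sumℚ-*-δ : ∀ {k} (f : Fin k → ℚ) (j : Fin k) → sumℚ (λ i → f i * δ i j) ≡ f j
sumℚ-*-δ f j = trans (sumℚ-single _ j (λ i i≢j → trans (cong (f i *_) (δ-≢ i≢j)) (*-zeroʳ (f i))))
  (trans (cong (f j *_) (δ-refl j)) (*-identityʳ (f j)))

sign-suc : ∀ n → sign (suc n) ≡ - sign n
sign-suc zero          = refl
sign-suc (suc zero)    = refl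
sign-suc (suc (suc n)) = sign-suc n

minor : ∀ {k} → Matrix (suc k) → Fin (suc k) → Matrix k
minor A j a c = A (suc a) (punchIn j c)

laplaceTerm : ∀ {k} → Matrix (suc k) → Fin (suc k) → ℚ
laplaceTerm A j = sign (toℕ j) * A zero j * det (minor A j)

det-cong : ∀ {k} {A B : Matrix k} → (∀ a c → A a c ≡ B a c) → det A ≡ det B
det-cong {zero}  A≗B = refl
det-cong {suc k} A≗B = sumℚ-cong λ j →
  cong₂ (λ x d → sign (toℕ j) * x * d) (A≗B zero j) (det-cong (λ a c → A≗B (suc a) (punchIn j c)))

minor-updateAt : ∀ {k} (A : Matrix (suc k)) r u j a c →
                 minor (updateAt A (suc r) (const u)) j a c ≡ updateAt (minor A j) r (const (u ∘ punchIn j)) a c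
minor-updateAt A r u j a c =
  cong-app (map-updateAt-local {f = _∘ punchIn j} {g = const u} {h = const (u ∘ punchIn j)} (A ∘ suc) r refl a) c

det-linearInRow : ∀ {k t} (A : Matrix k) r (u : Fin k → ℚ) (w : Fin t → ℚ) (v : Fin t → Fin k → ℚ) →
                  (∀ c → u c ≡ sumℚ (λ l → w l * v l c)) →
                  det (updateAt A r (const u)) ≡ sumℚ (λ l → w l * det (updateAt A r (const (v l))))
det-linearInRow {suc k} A r u w v u≗wv = begin
  sumℚ (laplaceTerm (Aᵣ u))
    ≡⟨ sumℚ-cong (termwise r) ⟩
  sumℚ (λ j → sumℚ (λ l → w l * laplaceTerm (Aᵣ (v l)) j))
    ≡⟨ sumℚ-comm (λ j l → w l * laplaceTerm (Aᵣ (v l)) j) ⟩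
  sumℚ (λ l → sumℚ (λ j → w l * laplaceTerm (Aᵣ (v l)) j))
    ≡⟨ sumℚ-cong (λ l → *-distribˡ-sumℚ (w l) (laplaceTerm (Aᵣ (v l)))) ⟨
  sumℚ (λ l → w l * det (Aᵣ (v l))) ∎
  where
  Aᵣ : (Fin (suc k) → ℚ) → Matrix (suc k)
  Aᵣ x = updateAt A r (const x)
  termwise : ∀ r j → laplaceTerm (updateAt A r (const u)) j
                     ≡ sumℚ (λ l → w l * laplaceTerm (updateAt A r (const (v l))) j)
  termwise zero j = begin
    s * u j * d                      ≡⟨ cong (λ x → s * x * d) (u≗wv j) ⟩
    s * sumℚ (λ l → w l * v l j) * d ≡⟨ shuffle s _ d ⟩
    (s * d) * sumℚ (λ l → w l * v l j) ≡⟨ *-distribˡ-sumℚ (s * d) (λ l → w l * v l j) ⟩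
    sumℚ (λ l → (s * d) * (w l * v l j)) ≡⟨ sumℚ-cong (λ l → shuffle′ s d (w l) (v l j)) ⟩
    sumℚ (λ l → w l * (s * v l j * d)) ∎
    where
    s d : ℚ
    s = sign (toℕ j)
    d = det (minor A j)
    shuffle : ∀ s x d → s * x * d ≡ (s * d) * x
    shuffle = solve 3 (λ s x d → s :* x :* d := (s :* d) :* x) refl
    shuffle′ : ∀ s d w x → (s * d) * (w * x) ≡ w * (s * x * d)
    shuffle′ = solve 4 (λ s d w x → (s :* d) :* (w :* x) := w :* (s :* x :* d)) refl
  termwise (suc r) j = begin
    s * a * det (minor (updateAt A (suc r) (const u)) j)
      ≡⟨ cong (s * a *_) (det-cong (minor-updateAt A r u j)) ⟩
    s * a * det (updateAt (minor A j) r (const (u ∘ punchIn j)))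
      ≡⟨ cong (s * a *_) (det-linearInRow (minor A j) r _ w _ (u≗wv ∘ punchIn j)) ⟩
    s * a * sumℚ (λ l → w l * det (updateAt (minor A j) r (const (v l ∘ punchIn j))))
      ≡⟨ *-distribˡ-sumℚ (s * a) (λ l → w l * det (updateAt (minor A j) r (const (v l ∘ punchIn j)))) ⟩
    sumℚ (λ l → s * a * (w l * det (updateAt (minor A j) r (const (v l ∘ punchIn j)))))
      ≡⟨ sumℚ-cong (λ l → trans (shuffle s a (w l) _)
           (cong (λ d → w l * (s * a * d)) (sym (det-cong (minor-updateAt A r (v l) j))))) ⟩
    sumℚ (λ l → w l * (s * a * det (minor (updateAt A (suc r) (const (v l))) j))) ∎
    where
    s a : ℚ
    s = sign (toℕ j)
    a = A zero j
    shuffle : ∀ s a w d → s * a * (w * d) ≡ w * (s * a * d)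
    shuffle = solve 4 (λ s a w d → s :* a :* (w :* d) := w :* (s :* a :* d)) refl

det-zeroRow : ∀ {k} (A : Matrix k) r → det (updateAt A r (const (λ _ → 0ℚ))) ≡ 0ℚ
det-zeroRow A r = det-linearInRow {t = 0} A r _ (λ ()) (λ ()) (λ _ → refl)

transpose : ∀ {k} → Matrix k → Matrix k
transpose A i j = A j i

det-columnExpansion : ∀ {k} (A : Matrix (suc k)) →
                      det A ≡ sumℚ (λ i → sign (toℕ i) * A i zero * det (λ a c → A (punchIn i a) (suc c)))
det-columnExpansion {zero}  A = refl
det-columnExpansion {suc k} A = cong (laplaceTerm A zero +_) (begin
  sumℚ (λ j → σ (suc j) * a j * det (minor A (suc j)))
    ≡⟨ sumℚ-cong (λ j → cong (σ (suc j) * a j *_) (det-columnExpansion (minor A (suc j)))) ⟩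
  sumℚ (λ j → σ (suc j) * a j * sumℚ (λ i → σ i * b i * D i j))
    ≡⟨ sumℚ-cong (λ j → *-distribˡ-sumℚ (σ (suc j) * a j) (λ i → σ i * b i * D i j)) ⟩
  sumℚ (λ j → sumℚ (λ i → σ (suc j) * a j * (σ i * b i * D i j)))
    ≡⟨ sumℚ-comm (λ j i → σ (suc j) * a j * (σ i * b i * D i j)) ⟩
  sumℚ (λ i → sumℚ (λ j → σ (suc j) * a j * (σ i * b i * D i j)))
    ≡⟨ sumℚ-cong (λ i → sumℚ-cong (λ j → exchange i j)) ⟩
  sumℚ (λ i → sumℚ (λ j → σ (suc i) * b i * (σ j * a j * D i j)))
    ≡⟨ sumℚ-cong (λ i → *-distribˡ-sumℚ (σ (suc i) * b i) (λ j → σ j * a j * D i j)) ⟨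
  sumℚ (λ i → σ (suc i) * b i * sumℚ (λ j → σ j * a j * D i j)) ∎)
  where
  σ : ∀ {m} → Fin m → ℚ
  σ i = sign (toℕ i)
  a b : Fin (suc k) → ℚ
  a j = A zero (suc j)
  b i = A (suc i) zero
  D : Fin (suc k) → Fin (suc k) → ℚ
  D i j = det (λ x y → A (suc (punchIn i x)) (suc (punchIn j y)))
  exchange : ∀ i j → σ (suc j) * a j * (σ i * b i * D i j) ≡ σ (suc i) * b i * (σ j * a j * D i j)
  exchange i j = begin
    sign (suc (toℕ j)) * a j * (σ i * b i * D i j)
      ≡⟨ cong (λ x → x * a j * (σ i * b i * D i j)) (sign-suc (toℕ j)) ⟩
    (- σ j) * a j * (σ i * b i * D i j)
      ≡⟨ swap (σ j) (a j) (σ i) (b i) (D i j) ⟩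
    (- σ i) * b i * (σ j * a j * D i j)
      ≡⟨ cong (λ x → x * b i * (σ j * a j * D i j)) (sign-suc (toℕ i)) ⟨
    sign (suc (toℕ i)) * b i * (σ j * a j * D i j) ∎
    where
    swap : ∀ s x t y d → (- s) * x * (t * y * d) ≡ (- t) * y * (s * x * d)
    swap = solve 5 (λ s x t y d → (:- s) :* x :* (t :* y :* d) := (:- t) :* y :* (s :* x :* d)) refl

det-transpose : ∀ {k} (A : Matrix k) → det (transpose A) ≡ det A
det-transpose {zero}  A = refl
det-transpose {suc k} A = trans
  (sumℚ-cong (λ i → cong (sign (toℕ i) * A i zero *_) (det-transpose (λ a c → A (punchIn i a) (suc c)))))
  (sym (det-columnExpansion A))

swap₀₁ : ∀ {k} → Fin (suc (suc k)) → Fin (suc (suc k))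
swap₀₁ zero          = suc zero
swap₀₁ (suc zero)    = zero
swap₀₁ (suc (suc i)) = suc (suc i)

sumℚ-swap₀₁ : ∀ {k} (f : Fin (suc (suc k)) → ℚ) → sumℚ (f ∘ swap₀₁) ≡ sumℚ f
sumℚ-swap₀₁ f = exchange (f zero) (f (suc zero)) (sumℚ (λ i → f (suc (suc i))))
  where
  exchange : ∀ x y r → y + (x + r) ≡ x + (y + r)
  exchange = solve 3 (λ x y r → y :+ (x :+ r) := x :+ (y :+ r)) refl

swapColumns₀₁ : ∀ {k} → Matrix (suc (suc k)) → Matrix (suc (suc k))
swapColumns₀₁ A r c = A r (swap₀₁ c)

mutual
  det-swapColumns₀₁ : ∀ {k} (A : Matrix (suc (suc k))) → det (swapColumns₀₁ A) ≡ - det A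
  det-swapColumns₀₁ A = begin
    det (swapColumns₀₁ A)                            ≡⟨ sumℚ-swap₀₁ (laplaceTerm (swapColumns₀₁ A)) ⟨
    sumℚ (laplaceTerm (swapColumns₀₁ A) ∘ swap₀₁)   ≡⟨ sumℚ-cong (laplaceTerm-swapColumns₀₁ A) ⟩
    sumℚ (λ j → - laplaceTerm A j)                   ≡⟨ sumℚ-neg (laplaceTerm A) ⟩
    - det A                                          ∎

  laplaceTerm-swapColumns₀₁ : ∀ {k} (A : Matrix (suc (suc k))) j →
                              laplaceTerm (swapColumns₀₁ A) (swap₀₁ j) ≡ - laplaceTerm A j
  laplaceTerm-swapColumns₀₁ A zero =
    trans (cong (λ d → - 1ℚ * A zero zero * d)
                (det-cong {A = minor (swapColumns₀₁ A) (suc zero)} {B = minor A zero}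
                          λ a → λ { zero → refl ; (suc c) → refl }))
          (flip (A zero zero) (det (minor A zero)))
    where
    flip : ∀ a d → - 1ℚ * a * d ≡ - (1ℚ * a * d)
    flip = solve 2 (λ a d → :- con 1ℚ :* a :* d := :- (con 1ℚ :* a :* d)) refl
  laplaceTerm-swapColumns₀₁ A (suc zero) =
    trans (cong (λ d → 1ℚ * A zero (suc zero) * d)
                (det-cong {A = minor (swapColumns₀₁ A) zero} {B = minor A (suc zero)}
                          λ a → λ { zero → refl ; (suc c) → refl }))
          (flip (A zero (suc zero)) (det (minor A (suc zero))))
    where
    flip : ∀ a d → 1ℚ * a * d ≡ - (- 1ℚ * a * d)
    flip = solve 2 (λ a d → con 1ℚ :* a :* d := :- (:- con 1ℚ :* a :* d)) refl
  laplaceTerm-swapColumns₀₁ {suc k} A (suc (suc j)) =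
    trans (cong (sign (toℕ j) * A zero (suc (suc j)) *_) (begin
      det (minor (swapColumns₀₁ A) (suc (suc j)))
        ≡⟨ det-cong {A = minor (swapColumns₀₁ A) (suc (suc j))}
                    {B = swapColumns₀₁ (minor A (suc (suc j)))}
                    (λ a → λ { zero → refl ; (suc zero) → refl ; (suc (suc c)) → refl }) ⟩
      det (swapColumns₀₁ (minor A (suc (suc j))))
        ≡⟨ det-swapColumns₀₁ (minor A (suc (suc j))) ⟩
      - det (minor A (suc (suc j))) ∎))
    (sym (neg-distribʳ-* (sign (toℕ j) * A zero (suc (suc j))) (det (minor A (suc (suc j))))))

det-swapRows₀₁ : ∀ {k} (A : Matrix (suc (suc k))) → det (A ∘ swap₀₁) ≡ - det A
det-swapRows₀₁ A = begin
  det (A ∘ swap₀₁)                   ≡⟨ det-transpose (A ∘ swap₀₁) ⟨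
  det (swapColumns₀₁ (transpose A))  ≡⟨ det-swapColumns₀₁ (transpose A) ⟩
  - det (transpose A)                ≡⟨ cong -_ (det-transpose A) ⟩
  - det A                            ∎

p≡-p⇒p≡0 : ∀ {p} → p ≡ - p → p ≡ 0ℚ
p≡-p⇒p≡0 {p} p≡-p = begin
  p               ≡⟨ halve p ⟩
  ½ * (p + p)     ≡⟨ cong (λ q → ½ * (p + q)) p≡-p ⟩
  ½ * (p + - p)   ≡⟨ cancel p ⟩
  0ℚ              ∎
  where
  halve : ∀ x → x ≡ ½ * (x + x)
  halve = solve 1 (λ x → x := con ½ :* (x :+ x)) refl
  cancel : ∀ x → ½ * (x + - x) ≡ 0ℚ
  cancel = solve 1 (λ x → con ½ :* (x :+ :- x) := con 0ℚ) refl

mutual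
  det-equalRows : ∀ {k} (A : Matrix k) {a b} → a ≢ b → A a ≡ A b → det A ≡ 0ℚ
  det-equalRows A {zero}  {zero}  0≢0  _   = contradiction refl 0≢0
  det-equalRows A {zero}  {suc b} _    A₀≡Aᵦ = det-equalRow₀ A b A₀≡Aᵦ
  det-equalRows A {suc a} {zero}  _    Aₐ≡A₀ = det-equalRow₀ A a (sym Aₐ≡A₀)
  det-equalRows A {suc a} {suc b} a≢b  Aₐ≡Aᵦ = det-equalSucRows A (a≢b ∘ cong suc) Aₐ≡Aᵦ

  det-equalSucRows : ∀ {k} (A : Matrix (suc k)) {a b} → a ≢ b → A (suc a) ≡ A (suc b) → det A ≡ 0ℚ
  det-equalSucRows A a≢b Aₐ≡Aᵦ = sumℚ-zero λ j →
    trans (cong (sign (toℕ j) * A zero j *_) (det-equalRows (minor A j) a≢b (cong (_∘ punchIn j) Aₐ≡Aᵦ)))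
          (*-zeroʳ (sign (toℕ j) * A zero j))

  -- Swapping the two top rows moves the repeated row below the top.
  det-equalRow₀ : ∀ {k} (A : Matrix (suc k)) b → A zero ≡ A (suc b) → det A ≡ 0ℚ
  det-equalRow₀ A zero A₀≡A₁ = p≡-p⇒p≡0 (trans (det-cong swap-invariant) (det-swapRows₀₁ A))
    where
    swap-invariant : ∀ r c → A r c ≡ A (swap₀₁ r) c
    swap-invariant zero          c = cong-app A₀≡A₁ c
    swap-invariant (suc zero)    c = cong-app (sym A₀≡A₁) c
    swap-invariant (suc (suc r)) c = refl
  det-equalRow₀ A (suc b) A₀≡Aᵦ = neg-injective (begin
    - det A             ≡⟨ det-swapRows₀₁ A ⟨
    det (A ∘ swap₀₁)    ≡⟨ det-equalSucRows (A ∘ swap₀₁) {zero} {suc b} (λ ()) A₀≡Aᵦ ⟩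
    - 0ℚ                ∎)

inject₁≢suc : ∀ {k} (i : Fin k) → inject₁ i ≢ suc i
inject₁≢suc zero    = λ ()
inject₁≢suc (suc i) = inject₁≢suc i ∘ Fin.suc-injective

punchIn-inject₁-self : ∀ {k} (i : Fin k) → punchIn (inject₁ i) i ≡ suc i
punchIn-inject₁-self zero    = refl
punchIn-inject₁-self (suc i) = cong suc (punchIn-inject₁-self i)

punchIn-suc-self : ∀ {k} (i : Fin k) → punchIn (suc i) i ≡ inject₁ i
punchIn-suc-self zero    = refl
punchIn-suc-self (suc i) = cong suc (punchIn-suc-self i)

punchIn-inject₁≡punchIn-suc : ∀ {k} {i a : Fin k} → a ≢ i → punchIn (inject₁ i) a ≡ punchIn (suc i) a
punchIn-inject₁≡punchIn-suc {i = zero}  {zero}  0≢0 = contradiction refl 0≢0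
punchIn-inject₁≡punchIn-suc {i = zero}  {suc a} _   = refl
punchIn-inject₁≡punchIn-suc {i = suc i} {zero}  _   = refl
punchIn-inject₁≡punchIn-suc {i = suc i} {suc a} a≢i = cong suc (punchIn-inject₁≡punchIn-suc (a≢i ∘ cong suc))

submatrix : ∀ {k} → Matrix (suc k) → Fin (suc k) → Fin (suc k) → Matrix k
submatrix A i j a c = A (punchIn i a) (punchIn j c)

-- Deleting row i or row i + 1 leaves matrices that differ only in row i; filling that row
-- with the vanishing combination Σ_l b_l A_l and expanding linearly gives the relation
-- (all other terms of the expansion repeat a row).
det-submatrix-adjacentRows : ∀ {k} (A : Matrix (suc k)) (b : Fin (suc k) → ℚ) →
                             (∀ c → sumℚ (λ l → b l * A l c) ≡ 0ℚ) → ∀ i j →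
                             b (inject₁ i) * det (submatrix A (suc i) j)
                               + b (suc i) * det (submatrix A (inject₁ i) j) ≡ 0ℚ
det-submatrix-adjacentRows {k} A b bA≡0 i j = begin
  b (inject₁ i) * det (N (suc i)) + b (suc i) * det (N (inject₁ i))
    ≡⟨ cong₂ (λ x y → b (inject₁ i) * x + b (suc i) * y) det-B-inject₁ det-B-suc ⟨
  b (inject₁ i) * det (B (inject₁ i)) + b (suc i) * det (B (suc i))
    ≡⟨ sumℚ-pair (λ l → b l * det (B l)) (inject₁≢suc i)
         (λ l l≢i l≢i+1 → trans (cong (b l *_) (det-B-other l l≢i l≢i+1)) (*-zeroʳ (b l))) ⟨
  sumℚ (λ l → b l * det (B l))
    ≡⟨ det-linearInRow (N (inject₁ i)) i (λ _ → 0ℚ) b R (λ c → sym (bA≡0 (punchIn j c))) ⟨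
  det (updateAt (N (inject₁ i)) i (const (λ _ → 0ℚ)))
    ≡⟨ det-zeroRow (N (inject₁ i)) i ⟩
  0ℚ ∎
  where
  R : Fin (suc k) → Fin k → ℚ
  R l c = A l (punchIn j c)
  N : Fin (suc k) → Matrix k
  N l = submatrix A l j
  B : Fin (suc k) → Matrix k
  B l = updateAt (N (inject₁ i)) i (const (R l))

  det-B-suc : det (B (suc i)) ≡ det (N (inject₁ i))
  det-B-suc = det-cong λ a → cong-app (updateAt-id-local i (N (inject₁ i)) (cong R (sym (punchIn-inject₁-self i))) a)

  det-B-inject₁ : det (B (inject₁ i)) ≡ det (N (suc i))
  det-B-inject₁ = det-cong λ a → cong-app (same-row a)
    where
    same-row : ∀ a → B (inject₁ i) a ≡ N (suc i) a
    same-row a with a Fin.≟ i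
    ... | yes refl = trans (updateAt-updates i (N (inject₁ i))) (cong R (sym (punchIn-suc-self i)))
    ... | no  a≢i  = trans (updateAt-minimal a i (N (inject₁ i)) a≢i) (cong R (punchIn-inject₁≡punchIn-suc a≢i))

  det-B-other : ∀ l → l ≢ inject₁ i → l ≢ suc i → det (B l) ≡ 0ℚ
  det-B-other l l≢i l≢i+1 = det-equalRows (B l) i≢a (trans (updateAt-updates i (N (inject₁ i)))
    (sym (trans (updateAt-minimal a i (N (inject₁ i)) (i≢a ∘ sym)) (cong R (Fin.punchIn-punchOut (l≢i ∘ sym))))))
    where
    a : Fin k
    a = punchOut (l≢i ∘ sym)
    i≢a : i ≢ a
    i≢a i≡a = l≢i+1 (begin
      l                          ≡⟨ Fin.punchIn-punchOut (l≢i ∘ sym) ⟨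
      punchIn (inject₁ i) a      ≡⟨ cong (punchIn (inject₁ i)) i≡a ⟨
      punchIn (inject₁ i) i      ≡⟨ punchIn-inject₁-self i ⟩
      suc i                      ∎)

cofactor-adjacentRows : ∀ {k} (A : Matrix (suc k)) (b : Fin (suc k) → ℚ) →
                        (∀ c → sumℚ (λ l → b l * A l c) ≡ 0ℚ) →
                        ∀ i j → b (suc i) * cofactor A (inject₁ i) j ≡ b (inject₁ i) * cofactor A (suc i) j
cofactor-adjacentRows A b bA≡0 i j = begin
  b (suc i) * (sign (toℕ (inject₁ i) ℕ.+ toℕ j) * d₀)
    ≡⟨ cong (λ m → b (suc i) * (sign (m ℕ.+ toℕ j) * d₀)) (Fin.toℕ-inject₁ i) ⟩
  b (suc i) * (σ * d₀)
    ≡⟨ expand σ (b (inject₁ i)) (b (suc i)) d₁ d₀ ⟩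
  σ * (b (inject₁ i) * d₁ + b (suc i) * d₀) + b (inject₁ i) * (- σ * d₁)
    ≡⟨ cong (λ z → σ * z + b (inject₁ i) * (- σ * d₁)) (det-submatrix-adjacentRows A b bA≡0 i j) ⟩
  σ * 0ℚ + b (inject₁ i) * (- σ * d₁)
    ≡⟨ collapse σ (b (inject₁ i) * (- σ * d₁)) ⟩
  b (inject₁ i) * (- σ * d₁)
    ≡⟨ cong (λ s → b (inject₁ i) * (s * d₁)) (sign-suc (toℕ i ℕ.+ toℕ j)) ⟨
  b (inject₁ i) * (sign (suc (toℕ i ℕ.+ toℕ j)) * d₁) ∎
  where
  σ d₀ d₁ : ℚ
  σ = sign (toℕ i ℕ.+ toℕ j)
  d₀ = det (submatrix A (inject₁ i) j)
  d₁ = det (submatrix A (suc i) j)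
  expand : ∀ σ x y u v → y * (σ * v) ≡ σ * (x * u + y * v) + x * (- σ * u)
  expand = solve 5 (λ σ x y u v → y :* (σ :* v) := σ :* (x :* u :+ y :* v) :+ x :* (:- σ :* u)) refl
  collapse : ∀ σ z → σ * 0ℚ + z ≡ z
  collapse = solve 2 (λ σ z → σ :* con 0ℚ :+ z := z) refl

cofactor-transpose : ∀ {k} (A : Matrix (suc k)) i j → cofactor (transpose A) j i ≡ cofactor A i j
cofactor-transpose A i j =
  cong₂ _*_ (cong sign (ℕ.+-comm (toℕ j) (toℕ i))) (det-transpose (submatrix A i j))

cofactor-adjacentColumns : ∀ {k} (A : Matrix (suc k)) (w : Fin (suc k) → ℚ) →
                           (∀ r → sumℚ (λ l → A r l * w l) ≡ 0ℚ) →
                           ∀ i j → w (suc j) * cofactor A i (inject₁ j) ≡ w (inject₁ j) * cofactor A i (suc j)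
cofactor-adjacentColumns A w Aw≡0 i j = begin
  w (suc j) * cofactor A i (inject₁ j)              ≡⟨ cong (w (suc j) *_) (cofactor-transpose A i (inject₁ j)) ⟨
  w (suc j) * cofactor (transpose A) (inject₁ j) i  ≡⟨ cofactor-adjacentRows (transpose A) w wAᵀ≡0 j i ⟩
  w (inject₁ j) * cofactor (transpose A) (suc j) i  ≡⟨ cong (w (inject₁ j) *_) (cofactor-transpose A i (suc j)) ⟩
  w (inject₁ j) * cofactor A i (suc j)              ∎
  where
  wAᵀ≡0 : ∀ c → sumℚ (λ l → w l * A c l) ≡ 0ℚ
  wAᵀ≡0 c = trans (sumℚ-cong (λ l → *-comm (w l) (A c l))) (Aw≡0 c)

proportional-fromAdjacent : ∀ {k} (u v : Fin (suc k) → ℚ) → (∀ i → u i ≢ 0ℚ) →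
                            (∀ i → u (suc i) * v (inject₁ i) ≡ u (inject₁ i) * v (suc i)) →
                            ∀ i → u zero * v i ≡ u i * v zero
proportional-fromAdjacent u v u≢0 adjacent =
  <-weakInduction (λ i → u zero * v i ≡ u i * v zero) refl step
  where
  step : ∀ i → u zero * v (inject₁ i) ≡ u (inject₁ i) * v zero → u zero * v (suc i) ≡ u (suc i) * v zero
  step i hyp = *-cancelˡ-≢0 (u≢0 (inject₁ i)) (begin
    u (inject₁ i) * (u zero * v (suc i))   ≡⟨ *-leftComm (u (inject₁ i)) (u zero) (v (suc i)) ⟩
    u zero * (u (inject₁ i) * v (suc i))   ≡⟨ cong (u zero *_) (adjacent i) ⟨
    u zero * (u (suc i) * v (inject₁ i))   ≡⟨ *-leftComm (u zero) (u (suc i)) (v (inject₁ i)) ⟩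
    u (suc i) * (u zero * v (inject₁ i))   ≡⟨ cong (u (suc i) *_) hyp ⟩
    u (suc i) * (u (inject₁ i) * v zero)   ≡⟨ *-leftComm (u (suc i)) (u (inject₁ i)) (v zero) ⟩
    u (inject₁ i) * (u (suc i) * v zero)   ∎)

cofactor-rankOne : ∀ {k} (A : Matrix (suc k)) (b w : Fin (suc k) → ℚ) →
                   (∀ i → b i ≢ 0ℚ) → (∀ j → w j ≢ 0ℚ) →
                   (∀ i → sumℚ (λ l → A i l * w l) ≡ 0ℚ) → (∀ j → sumℚ (λ l → b l * A l j) ≡ 0ℚ) →
                   ∃ λ γ → ∀ i j → cofactor A i j ≡ γ * (b i * w j)
cofactor-rankOne {k} A b w b≢0 w≢0 Aw≡0 bA≡0 = γ , λ i j → *-cancelˡ-≢0 d≢0 (begin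
  d * C i j                                ≡⟨ *-assoc (b zero) (w zero) (C i j) ⟩
  b zero * (w zero * C i j)                ≡⟨ cong (b zero *_) (columns i j) ⟩
  b zero * (w j * C i zero)                ≡⟨ *-leftComm (b zero) (w j) (C i zero) ⟩
  w j * (b zero * C i zero)                ≡⟨ cong (w j *_) (rows i) ⟩
  w j * (b i * C zero zero)                ≡⟨ rearrange (w j) (b i) (C zero zero) ⟩
  1ℚ * (C zero zero * (b i * w j))         ≡⟨ cong (_* (C zero zero * (b i * w j))) (*-inverseʳ d) ⟨
  (d * d⁻¹) * (C zero zero * (b i * w j))  ≡⟨ regroup d d⁻¹ (C zero zero) (b i * w j) ⟩
  d * (γ * (b i * w j))                    ∎)
  where
  C : Fin (suc k) → Fin (suc k) → ℚ
  C = cofactor A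
  d : ℚ
  d = b zero * w zero
  d≢0 : d ≢ 0ℚ
  d≢0 = *-≢0 (b≢0 zero) (w≢0 zero)
  instance
    d-nonZero : ℚ.NonZero d
    d-nonZero = ℚ.≢-nonZero d≢0
  d⁻¹ γ : ℚ
  d⁻¹ = ℚ.1/ d
  γ = C zero zero * d⁻¹
  columns : ∀ i j → w zero * C i j ≡ w j * C i zero
  columns i = proportional-fromAdjacent w (C i) w≢0 (cofactor-adjacentColumns A w Aw≡0 i)
  rows : ∀ i → b zero * C i zero ≡ b i * C zero zero
  rows = proportional-fromAdjacent b (λ i → C i zero) b≢0 (λ i → cofactor-adjacentRows A b bA≡0 i zero)
  rearrange : ∀ w b c → w * (b * c) ≡ 1ℚ * (c * (b * w))
  rearrange = solve 3 (λ w b c → w :* (b :* c) := con 1ℚ :* (c :* (b :* w))) refl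
  regroup : ∀ d e c x → (d * e) * (c * x) ≡ d * (c * e * x)
  regroup = solve 4 (λ d e c x → (d :* e) :* (c :* x) := d :* (c :* e :* x)) refl

module IdentityMinusLowRank {s c : ℕ} (x y : Fin s → Fin c → ℚ) (α : Fin c → ℚ) (α≢0 : ∀ p → α p ≢ 0ℚ) where

  Z : Matrix s
  Z i j = δ i j - sumℚ (λ p → (x j p * y i p) /ℚ α p)

  private
    α⁻¹ : Fin c → ℚ
    α⁻¹ p = (ℚ.1/ α p) {{ℚ.≢-nonZero (α≢0 p)}}

    /α≡*α⁻¹ : ∀ a p → a /ℚ α p ≡ a * α⁻¹ p
    /α≡*α⁻¹ a p = /ℚ≡*1/ a (α≢0 p)

    *α⁻¹*α : ∀ a p → (a * α⁻¹ p) * α p ≡ a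
    *α⁻¹*α a p = begin
      (a * α⁻¹ p) * α p   ≡⟨ *-assoc a (α⁻¹ p) (α p) ⟩
      a * (α⁻¹ p * α p)   ≡⟨ cong (a *_) (*-inverseˡ (α p) {{ℚ.≢-nonZero (α≢0 p)}}) ⟩
      a * 1ℚ              ≡⟨ *-identityʳ a ⟩
      a                   ∎

  Z-rightNull : (w : Fin s → ℚ) → (∀ p → sumℚ (λ j → x j p * w j) ≡ α p) → (∀ i → sumℚ (y i) ≡ w i) →
                ∀ i → sumℚ (λ j → Z i j * w j) ≡ 0ℚ
  Z-rightNull w xw≡α Σy≡w i = begin
    sumℚ (λ j → Z i j * w j)                            ≡⟨ sumℚ-cong (λ j → [y-z]x≈yx-zx (w j) (δ i j) (S j)) ⟩
    sumℚ (λ j → δ i j * w j - S j * w j)                ≡⟨ sumℚ-- (λ j → δ i j * w j) (λ j → S j * w j) ⟩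
    sumℚ (λ j → δ i j * w j) - sumℚ (λ j → S j * w j)  ≡⟨ cong₂ _-_ (sumℚ-δ-* i w) Sw≡w ⟩
    w i - w i                                           ≡⟨ +-inverseʳ (w i) ⟩
    0ℚ                                                  ∎
    where
    S : Fin s → ℚ
    S j = sumℚ (λ p → (x j p * y i p) /ℚ α p)
    column : ∀ p → sumℚ (λ j → w j * ((x j p * y i p) /ℚ α p)) ≡ y i p
    column p = begin
      sumℚ (λ j → w j * ((x j p * y i p) /ℚ α p))
        ≡⟨ sumℚ-cong (λ j → trans (cong (w j *_) (/α≡*α⁻¹ _ p)) (shuffle (w j) (x j p) (y i p) (α⁻¹ p))) ⟩
      sumℚ (λ j → (y i p * α⁻¹ p) * (x j p * w j))   ≡⟨ *-distribˡ-sumℚ (y i p * α⁻¹ p) (λ j → x j p * w j) ⟨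
      (y i p * α⁻¹ p) * sumℚ (λ j → x j p * w j)     ≡⟨ cong ((y i p * α⁻¹ p) *_) (xw≡α p) ⟩
      (y i p * α⁻¹ p) * α p                          ≡⟨ *α⁻¹*α (y i p) p ⟩
      y i p                                          ∎
      where
      shuffle : ∀ w x y e → w * ((x * y) * e) ≡ (y * e) * (x * w)
      shuffle = solve 4 (λ w x y e → w :* ((x :* y) :* e) := (y :* e) :* (x :* w)) refl
    Sw≡w : sumℚ (λ j → S j * w j) ≡ w i
    Sw≡w = begin
      sumℚ (λ j → S j * w j)                                     ≡⟨ sumℚ-cong (λ j → *-comm (S j) (w j)) ⟩
      sumℚ (λ j → w j * S j)                                     ≡⟨ sumℚ-*-sumℚ w (λ j p → (x j p * y i p) /ℚ α p) ⟩
      sumℚ (λ p → sumℚ (λ j → w j * ((x j p * y i p) /ℚ α p)))  ≡⟨ sumℚ-cong column ⟩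
      sumℚ (y i)                                                 ≡⟨ Σy≡w i ⟩
      w i                                                        ∎

  Z-leftNull : (b : Fin s → ℚ) → (∀ p → sumℚ (λ i → b i * y i p) ≡ α p) → (∀ j → sumℚ (x j) ≡ b j) →
               ∀ j → sumℚ (λ i → b i * Z i j) ≡ 0ℚ
  Z-leftNull b by≡α Σx≡b j = begin
    sumℚ (λ i → b i * Z i j)                            ≡⟨ sumℚ-cong (λ i → x[y-z]≈xy-xz (b i) (δ i j) (S i)) ⟩
    sumℚ (λ i → b i * δ i j - b i * S i)                ≡⟨ sumℚ-- (λ i → b i * δ i j) (λ i → b i * S i) ⟩
    sumℚ (λ i → b i * δ i j) - sumℚ (λ i → b i * S i)  ≡⟨ cong₂ _-_ (sumℚ-*-δ b j) bS≡b ⟩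
    b j - b j                                           ≡⟨ +-inverseʳ (b j) ⟩
    0ℚ                                                  ∎
    where
    S : Fin s → ℚ
    S i = sumℚ (λ p → (x j p * y i p) /ℚ α p)
    row : ∀ p → sumℚ (λ i → b i * ((x j p * y i p) /ℚ α p)) ≡ x j p
    row p = begin
      sumℚ (λ i → b i * ((x j p * y i p) /ℚ α p))
        ≡⟨ sumℚ-cong (λ i → trans (cong (b i *_) (/α≡*α⁻¹ _ p)) (shuffle (b i) (x j p) (y i p) (α⁻¹ p))) ⟩
      sumℚ (λ i → (x j p * α⁻¹ p) * (b i * y i p))   ≡⟨ *-distribˡ-sumℚ (x j p * α⁻¹ p) (λ i → b i * y i p) ⟨
      (x j p * α⁻¹ p) * sumℚ (λ i → b i * y i p)     ≡⟨ cong ((x j p * α⁻¹ p) *_) (by≡α p) ⟩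
      (x j p * α⁻¹ p) * α p                          ≡⟨ *α⁻¹*α (x j p) p ⟩
      x j p                                          ∎
      where
      shuffle : ∀ b x y e → b * ((x * y) * e) ≡ (x * e) * (b * y)
      shuffle = solve 4 (λ b x y e → b :* ((x :* y) :* e) := (x :* e) :* (b :* y)) refl
    bS≡b : sumℚ (λ i → b i * S i) ≡ b j
    bS≡b = begin
      sumℚ (λ i → b i * S i)                                     ≡⟨ sumℚ-*-sumℚ b (λ i p → (x j p * y i p) /ℚ α p) ⟩
      sumℚ (λ p → sumℚ (λ i → b i * ((x j p * y i p) /ℚ α p)))  ≡⟨ sumℚ-cong row ⟩
      sumℚ (x j)                                                 ≡⟨ Σx≡b j ⟩
      b j                                                        ∎

module ComponentCounts {s : ℕ} (ns : Fin (suc s) → ℕ) {c : ℕ} (comp : Vertex ns → Fin c) where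

  n : ℚ
  n = ℕ→ℚ (nTot ns)

  b w : Fin (suc s) → ℚ
  b i = ℕ→ℚ (ns i)
  w i = n - b i

  x : Fin (suc s) → Fin c → ℚ
  x i p = ℕ→ℚ (nip ns comp i p)

  m : Fin c → ℚ
  m p = ℕ→ℚ (mp ns comp p)

  α : Fin c → ℚ
  α = αp ns comp

  sumℚ-x-parts : ∀ p → sumℚ (λ i → x i p) ≡ m p
  sumℚ-x-parts p = sym (ℕ→ℚ-sumℕ (λ i → nip ns comp i p))

  -- Each vertex of X_i lies in exactly one component.
  sumℚ-x-components : ∀ i → sumℚ (x i) ≡ b i
  sumℚ-x-components i = begin
    sumℚ (x i)                                    ≡⟨ sumℚ-cong (λ p → ℕ→ℚ-sumℕ (indicator p)) ⟩
    sumℚ (λ p → sumℚ (λ a → ℕ→ℚ (indicator p a))) ≡⟨ sumℚ-comm (λ p a → ℕ→ℚ (indicator p a)) ⟩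
    sumℚ (λ a → sumℚ (λ p → ℕ→ℚ (indicator p a))) ≡⟨ sumℚ-cong (λ a → sumℚ-δ (comp (i , a))) ⟩
    sumℚ {ns i} (λ _ → 1ℚ)                        ≡⟨ sumℚ-1 (ns i) ⟩
    b i                                           ∎
    where
    indicator : Fin c → Fin (ns i) → ℕ
    indicator p a = if does (comp (i , a) Fin.≟ p) then 1 else 0
    sumℚ-δ : ∀ q → sumℚ (λ p → ℕ→ℚ (if does (q Fin.≟ p) then 1 else 0)) ≡ 1ℚ
    sumℚ-δ q = begin
      sumℚ (λ p → ℕ→ℚ (if does (q Fin.≟ p) then 1 else 0)) ≡⟨ sumℚ-cong (λ p → if-float ℕ→ℚ (does (q Fin.≟ p))) ⟩
      sumℚ (δ q)                                             ≡⟨ sumℚ-cong (λ p → *-identityʳ (δ q p)) ⟨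
      sumℚ (λ p → δ q p * 1ℚ)                                ≡⟨ sumℚ-δ-* q (λ _ → 1ℚ) ⟩
      1ℚ                                                     ∎

  sumℚ-m : sumℚ m ≡ n
  sumℚ-m = begin
    sumℚ m                          ≡⟨ sumℚ-cong sumℚ-x-parts ⟨
    sumℚ (λ p → sumℚ (λ i → x i p)) ≡⟨ sumℚ-comm (λ p i → x i p) ⟩
    sumℚ (λ i → sumℚ (x i))         ≡⟨ sumℚ-cong sumℚ-x-components ⟩
    sumℚ b                          ≡⟨ ℕ→ℚ-sumℕ ns ⟨
    n                               ∎

  sumℚ-m-x : ∀ i → sumℚ (λ p → m p - x i p) ≡ w i
  sumℚ-m-x i = trans (sumℚ-- m (x i)) (cong₂ _-_ sumℚ-m (sumℚ-x-components i))

  α≡sumℚ-x*w : ∀ p → sumℚ (λ j → x j p * w j) ≡ α p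
  α≡sumℚ-x*w p = begin
    sumℚ (λ j → x j p * (n - b j))               ≡⟨ sumℚ-cong (λ j → expand (x j p) n (b j)) ⟩
    sumℚ (λ j → n * x j p - b j * x j p)         ≡⟨ sumℚ-- (λ j → n * x j p) (λ j → b j * x j p) ⟩
    sumℚ (λ j → n * x j p) - Σbx                 ≡⟨ cong (_- Σbx) (*-distribˡ-sumℚ n (λ j → x j p)) ⟨
    n * sumℚ (λ j → x j p) - Σbx                 ≡⟨ cong (λ z → n * z - Σbx) (sumℚ-x-parts p) ⟩
    n * m p - Σbx                                ∎
    where
    Σbx : ℚ
    Σbx = sumℚ (λ j → b j * x j p)
    expand : ∀ x n b → x * (n - b) ≡ n * x - b * x
    expand = solve 3 (λ x n b → x :* (n :- b) := n :* x :- b :* x) refl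

  α≡sumℚ-b*[m-x] : ∀ p → sumℚ (λ i → b i * (m p - x i p)) ≡ α p
  α≡sumℚ-b*[m-x] p = begin
    sumℚ (λ i → b i * (m p - x i p))             ≡⟨ sumℚ-cong (λ i → expand (b i) (m p) (x i p)) ⟩
    sumℚ (λ i → m p * b i - b i * x i p)         ≡⟨ sumℚ-- (λ i → m p * b i) (λ i → b i * x i p) ⟩
    sumℚ (λ i → m p * b i) - Σbx                 ≡⟨ cong (_- Σbx) (*-distribˡ-sumℚ (m p) b) ⟨
    m p * sumℚ b - Σbx                           ≡⟨ cong (λ z → m p * z - Σbx) (ℕ→ℚ-sumℕ ns) ⟨
    m p * n - Σbx                                ≡⟨ cong (_- Σbx) (*-comm (m p) n) ⟩
    n * m p - Σbx                                ∎
    where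
    Σbx : ℚ
    Σbx = sumℚ (λ i → b i * x i p)
    expand : ∀ b m x → b * (m - x) ≡ m * b - b * x
    expand = solve 3 (λ b m x → b :* (m :- x) := m :* b :- b :* x) refl

  w≡ℕ→ℚ : ∀ j → w j ≡ ℕ→ℚ (sumℕ (ns ∘ punchIn j))
  w≡ℕ→ℚ j = begin
    n - b j                                  ≡⟨ cong (λ k → ℕ→ℚ k - b j) (sumℕ-punchIn ns j) ⟩
    ℕ→ℚ (ns j ℕ.+ rest) - b j                ≡⟨ cong (_- b j) (ℕ→ℚ-+ (ns j) rest) ⟩
    (b j + ℕ→ℚ rest) - b j                   ≡⟨ cancel (b j) (ℕ→ℚ rest) ⟩
    ℕ→ℚ rest                                 ∎
    where
    rest : ℕ
    rest = sumℕ (ns ∘ punchIn j)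
    cancel : ∀ a r → (a + r) - a ≡ r
    cancel = solve 2 (λ a r → (a :+ r) :- a := r) refl

  α≢0 : (∀ j → 1 ≤ sumℕ (ns ∘ punchIn j)) → (∀ p → ∃ λ v → comp v ≡ p) → ∀ p → α p ≢ 0ℚ
  α≢0 rest≥1 nonempty p with nonempty p
  ... | (i , a) , comp[i,a]≡p = λ α≡0 → terms≢0 (trans (sym α≡ℕ→ℚ) α≡0)
    where
    terms : Fin (suc s) → ℕ
    terms j = nip ns comp j p ℕ.* sumℕ (ns ∘ punchIn j)
    x·w≡terms : ∀ j → x j p * w j ≡ ℕ→ℚ (terms j)
    x·w≡terms j = trans (cong (x j p *_) (w≡ℕ→ℚ j)) (sym (ℕ→ℚ-* (nip ns comp j p) (sumℕ (ns ∘ punchIn j))))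
    α≡ℕ→ℚ : α p ≡ ℕ→ℚ (sumℕ terms)
    α≡ℕ→ℚ = begin
      α p                       ≡⟨ α≡sumℚ-x*w p ⟨
      sumℚ (λ j → x j p * w j)  ≡⟨ sumℚ-cong x·w≡terms ⟩
      sumℚ (ℕ→ℚ ∘ terms)        ≡⟨ ℕ→ℚ-sumℕ terms ⟨
      ℕ→ℚ (sumℕ terms)          ∎
    nip≥1 : 1 ≤ nip ns comp i p
    nip≥1 = ℕ.≤-trans (ℕ.≤-reflexive (cong (if_then 1 else 0) (sym (dec-true (comp (i , a) Fin.≟ p) comp[i,a]≡p))))
                      (≤-sumℕ _ a)
    terms≢0 : ℕ→ℚ (sumℕ terms) ≢ 0ℚ
    terms≢0 = ℕ→ℚ-≢0 (ℕ.≤-trans (ℕ.*-mono-≤ nip≥1 (rest≥1 i)) (≤-sumℕ terms i))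

-- Only the nonemptiness of the components enters (it makes every α_p positive).
proposition4p3 : (s : ℕ) → 2 ≤ s → (ns : Fin s → ℕ) → (∀ i → 1 ≤ ns i)
    → (F : Vertex ns → Vertex ns → Set) → IsSpanningForest ns F
    → (c : ℕ) (comp : Vertex ns → Fin c) → AreComponents F c comp
    → ∃ λ (γ : ℚ) →
        (∀ i j → adjugate (Z0 ns comp) i j
                   ≡ γ * ((ℕ→ℚ (nTot ns) - ℕ→ℚ (ns i)) * ℕ→ℚ (ns j)))
      × (∀ i j → γ ≡ cofactor (Z0 ns comp) i j
                       /ℚ (ℕ→ℚ (ns i) * (ℕ→ℚ (nTot ns) - ℕ→ℚ (ns j))))
proposition4p3 _ (s≤s (s≤s z≤n)) ns ns≥1 _ _ c comp (_ , _ , nonempty) =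
  γ , (λ i j → trans (cofactor≡ j i) (cong (γ *_) (*-comm (b j) (w i))))
    , (λ i j → sym (trans (cong (_/ℚ (b i * w j)) (cofactor≡ i j)) (*-/ℚ-cancel γ (*-≢0 (b≢0 i) (w≢0 j)))))
  where
  open ComponentCounts ns comp
  rest≥1 : ∀ j → 1 ≤ sumℕ (ns ∘ punchIn j)
  rest≥1 j = ℕ.≤-trans (ns≥1 (punchIn j zero)) (ℕ.m≤m+n _ _)
  b≢0 : ∀ i → b i ≢ 0ℚ
  b≢0 i = ℕ→ℚ-≢0 (ns≥1 i)
  w≢0 : ∀ j → w j ≢ 0ℚ
  w≢0 j w≡0 = ℕ→ℚ-≢0 (rest≥1 j) (trans (sym (w≡ℕ→ℚ j)) w≡0)
  -- The matrix Z below unfolds to Z0 ns comp.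
  open IdentityMinusLowRank x (λ i p → m p - x i p) α (α≢0 rest≥1 nonempty)
  rankOne : ∃ λ γ → ∀ i j → cofactor Z i j ≡ γ * (b i * w j)
  rankOne = cofactor-rankOne Z b w b≢0 w≢0 (Z-rightNull w α≡sumℚ-x*w sumℚ-m-x)
                                           (Z-leftNull b α≡sumℚ-b*[m-x] sumℚ-x-components)
  γ : ℚ
  γ = proj₁ rankOne
  cofactor≡ : ∀ i j → cofactor Z i j ≡ γ * (b i * w j)
  cofactor≡ = proj₂ rankOne
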